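{- For all positive integers $k$ and $r$ there exists $q_0$ such that the following holds for every integer $q\ge q_0$. Let $\mathcal{H}$ be a 3-uniform hypergraph containing a copy $S$ of $S_q^3$, and suppose each pair $e$ of vertices contained in some hyperedge of $S$ is assigned a nonnegative integer $w(e)\le k$ such that $e$ is contained in at least $w(e)+1$ hyperedges of $\mathcal{H}$. Then there is a copy $S'$ of $S_r^3$ consisting of $r$ of the hyperedges of $S$ which is nice, i.e., for every pair $e$ contained in a hyperedge of $S'$, the link set of $e$ in $\mathcal{H}$ contains at least $w(e)$ vertices not belonging to $S'$.
   Context: $S_q^3$ denotes the 3-graph consisting of $q$ hyperedges sharing exactly one common vertex (the center) and otherwise pairwise disjoint. The link set of a pair $e$ of vertices in a 3-graph $\mathcal{H}$ is the set of vertices $x$ such that $e\cup\{x\}$ is a hyperedge of $\mathcal{H}$. -}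

module Defs where

open import Data.Nat using (ℕ; suc; _≤_)
open import Data.Fin using (Fin)
open import Data.Fin.Subset using (Subset; ⁅_⁆; _∪_; _⊆_; ∣_∣)
open import Data.Product using (Σ; _×_)
open import Relation.Binary.PropositionalEquality using (_≡_; _≢_)
open import Function.Definitions using (Injective)

AtLeast : {A : Set} → ℕ → (A → Set) → Set
AtLeast {A} m P = Σ (Fin m → A) λ f → Injective _≡_ _≡_ f × (∀ i → P (f i))

record Hypergraph3 : Set₁ where
  field
    n       : ℕ
    Edge    : Subset n → Set
    uniform : ∀ e → Edge e → ∣ e ∣ ≡ 3

open Hypergraph3 public

pair : {n : ℕ} → Fin n → Fin n → Subset n
pair u v = ⁅ u ⁆ ∪ ⁅ v ⁆

triple : {n : ℕ} → Fin n → Fin n → Fin n → Subset n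
triple u v x = ⁅ u ⁆ ∪ ⁅ v ⁆ ∪ ⁅ x ⁆

InLink : (H : Hypergraph3) → Fin (n H) → Fin (n H) → Fin (n H) → Set
InLink H u v x = Edge H (triple u v x)

PairDegAtLeast : (H : Hypergraph3) → ℕ → Fin (n H) → Fin (n H) → Set
PairDegAtLeast H m u v = AtLeast m (λ h → Edge H h × pair u v ⊆ h)

-- a copy of S_q^3 in H: center c, hyperedges {c, a i, b i} (i : Fin q),
-- all 2q+1 vertices pairwise distinct
record Star (H : Hypergraph3) (q : ℕ) : Set where
  field
    c     : Fin (n H)
    a b   : Fin q → Fin (n H)
    a≢c   : ∀ i → a i ≢ c
    b≢c   : ∀ i → b i ≢ c
    a≢b   : ∀ i j → a i ≢ b j
    a-inj : Injective _≡_ _≡_ a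
    b-inj : Injective _≡_ _≡_ b
    edges : ∀ i → Edge H (triple c (a i) (b i))

open Star public

record Weights {H : Hypergraph3} {q : ℕ} (S : Star H q) (k : ℕ) : Set where
  field
    wca wcb wab : Fin q → ℕ
    wca≤ : ∀ i → wca i ≤ k
    wcb≤ : ∀ i → wcb i ≤ k
    wab≤ : ∀ i → wab i ≤ k
    degca : ∀ i → PairDegAtLeast H (suc (wca i)) (c S) (a S i)
    degcb : ∀ i → PairDegAtLeast H (suc (wcb i)) (c S) (b S i)
    degab : ∀ i → PairDegAtLeast H (suc (wab i)) (a S i) (b S i)

open Weights public

NotInSub : {H : Hypergraph3} {q r : ℕ} → Star H q → (Fin r → Fin q) → Fin (n H) → Set
NotInSub S g x = x ≢ c S × (∀ j → x ≢ a S (g j)) × (∀ j → x ≢ b S (g j))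

GoodPair : {H : Hypergraph3} {q r : ℕ} → Star H q → (Fin r → Fin q) →
           ℕ → Fin (n H) → Fin (n H) → Set
GoodPair {H} S g m u v = AtLeast m (λ x → InLink H u v x × NotInSub S g x)

Nice : {H : Hypergraph3} {q r k : ℕ} (S : Star H q) → Weights S k → (Fin r → Fin q) → Set
Nice S w g = ∀ j →
    GoodPair S g (wca w (g j)) (c S) (a S (g j))
  × GoodPair S g (wcb w (g j)) (c S) (b S (g j))
  × GoodPair S g (wab w (g j)) (a S (g j)) (b S (g j))

{-# OPTIONS --safe #-}
-- Each pair e of the i-th hyperedge {c, aᵢ, bᵢ} of S lies in w(e)+1 hyperedges of H, so it has
-- w(e)+1 distinct link vertices, and at least w(e) of them avoid the third vertex of that
-- hyperedge. These at most 3(k+1) link vertices of hyperedge i meet at most 3(k+1) other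
-- petals {aⱼ, bⱼ}; write i ⇝ j when they meet the j-th one. A digraph of bounded out-degree on
-- enough vertices has r pairwise non-adjacent vertices: fix a vertex v; either the vertices
-- not adjacent to v contain r−1 independent ones, or the in-neighbours of v are numerous, and
-- among them every out-degree is one smaller. The r hyperedges of S so chosen form a nice copy
-- of S_r^3, since no link vertex of one of them lies on another.
module Submission where

open import Defs
open import Data.Bool using (true; false)
open import Data.Vec using ([]; _∷_)
open import Data.Fin using (Fin; zero; suc; punchIn)
open import Data.Fin.Properties
  using (any?; punchIn-injective; punchInᵢ≢i; suc-injective)
  renaming (_≟_ to _≟ᶠ_)
open import Data.Fin.Subset using (Subset; ⁅_⁆; _∪_; _⊆_; ∣_∣) renaming (_∈_ to _∈ₛ_)
open import Data.Fin.Subset.Properties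
  using ( x∈p⇒∣p-x∣<∣p∣; x∈p∧x≢y⇒x∈p-y; ⊆-antisym; p⊆q⇒∣p∣≤∣q∣
        ; x∈p∪q⁺; x∈p∪q⁻; x∈⁅x⁆; x∈⁅y⁆⇒x≡y; ∣⁅x⁆∣≡1)
  renaming (_∈?_ to _∈ₛ?_)
open import Data.List using (List; []; _∷_; length; filter; _++_; tabulate; allFin; mapMaybe)
open import Data.List.Properties
  using (length-++; length-++-sucʳ; length-tabulate; length-mapMaybe; filter-accept)
open import Data.List.Membership.Propositional using (_∈_)
open import Data.List.Membership.Propositional.Properties
  using (∈-filter⁻; ∈-∃++; ∈-++⁻; ∈-++⁺ˡ; ∈-++⁺ʳ; ∈-tabulate⁺)
import Data.List.Membership.DecPropositional as DecMembership
open import Data.List.Relation.Unary.All as All using (All; []; _∷_)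
open import Data.List.Relation.Unary.AllPairs using ([]; _∷_)
import Data.List.Relation.Unary.Any as Any
open import Data.List.Relation.Unary.Any using (here; there)
import Data.List.Relation.Unary.Any.Properties as Any
open import Data.List.Relation.Unary.Unique.Propositional using (Unique)
import Data.List.Relation.Unary.Unique.Propositional.Properties as Unique
open import Data.List.Relation.Binary.Sublist.Propositional
  using (_∷ʳ_; ⊆-refl; ⊆-trans) renaming (_⊆_ to _⊑_)
open import Data.List.Relation.Binary.Sublist.Propositional.Properties
  using (filter-⊆; filter⁺; length-mono-≤)
open import Data.Maybe using (Maybe; just; nothing)
import Data.Maybe.Relation.Unary.Any as Maybe
open import Data.Nat using (ℕ; zero; suc; _+_; _*_; _≤_; _<_; z≤n; s≤s; s≤s⁻¹; _≤?_)
open import Data.Nat.Properties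
  using ( ≤-trans; ≤-<-trans; ≤-reflexive; <⇒≤; <⇒≢; ≰⇒>; n≤1+n
        ; +-suc; +-assoc; +-identityʳ; +-mono-≤; +-monoˡ-≤; +-monoʳ-≤; +-monoʳ-<
        ; +-cancelˡ-≤; +-cancelʳ-<; module ≤-Reasoning)
open import Data.Product using (Σ; _×_; _,_; proj₁; proj₂; ∃-syntax)
open import Data.Sum using (_⊎_; inj₁; inj₂)
open import Function using (_∘_; id)
open import Function.Definitions using (Injective)
open import Relation.Binary.Definitions using (Decidable; DecidableEquality)
open import Relation.Binary.PropositionalEquality
  using (_≡_; _≢_; refl; sym; trans; cong; cong₂; subst; ≢-sym)
open import Relation.Nullary using (¬_; Dec; yes; no; ¬?; contradiction)
open import Relation.Nullary.Decidable using (_×-dec_; _⊎-dec_)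
import Relation.Unary as U

module _ {A : Set} where

  length-filter-¬ : ∀ {P : A → Set} (P? : U.Decidable P) xs →
    length (filter P? xs) + length (filter (¬? ∘ P?) xs) ≡ length xs
  length-filter-¬ P? [] = refl
  length-filter-¬ P? (x ∷ xs) with P? x
  ... | yes _ = cong suc (length-filter-¬ P? xs)
  ... | no  _ = trans (+-suc _ _) (cong suc (length-filter-¬ P? xs))

  Unique⇒length≤ : ∀ {xs ys : List A} → Unique xs → (∀ {x} → x ∈ xs → x ∈ ys) →
    length xs ≤ length ys
  Unique⇒length≤ {[]}     _              _     = z≤n
  Unique⇒length≤ {x ∷ xs} (x∉xs ∷ xs!) xs⊆ys
    with ys₁ , ys₂ , refl ← ∈-∃++ (xs⊆ys (here refl)) =
    ≤-trans (s≤s (Unique⇒length≤ xs! skip)) (≤-reflexive (sym (length-++-sucʳ ys₁ x ys₂)))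
    where
    skip : ∀ {z} → z ∈ xs → z ∈ ys₁ ++ ys₂
    skip z∈xs with ∈-++⁻ ys₁ (xs⊆ys (there z∈xs))
    ... | inj₁ z∈ys₁         = ∈-++⁺ˡ z∈ys₁
    ... | inj₂ (here refl)   = contradiction refl (All.lookup x∉xs z∈xs)
    ... | inj₂ (there z∈ys₂) = ∈-++⁺ʳ ys₁ z∈ys₂

length-tabulate-++ : ∀ {A : Set} {m} (f : Fin m → A) ys → length (tabulate f ++ ys) ≡ m + length ys
length-tabulate-++ f ys = trans (length-++ (tabulate f)) (cong (_+ length ys) (length-tabulate f))

module _ {A B : Set} where

  ∈-mapMaybe⁺ : ∀ {f : A → Maybe B} {x y xs} → x ∈ xs → f x ≡ just y → y ∈ mapMaybe f xs
  ∈-mapMaybe⁺ {f} {xs = xs} x∈xs fx≡y = Any.mapMaybe⁺ f xs (Any.map⁺ (Any.map hit x∈xs))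
    where
    hit : ∀ {z} → _ ≡ z → Maybe.Any (_ ≡_) (f z)
    hit refl = subst (Maybe.Any (_ ≡_)) (sym fx≡y) (Maybe.just refl)

independenceThreshold : ℕ → ℕ → ℕ
independenceThreshold d       zero    = 0
independenceThreshold zero    (suc r) = 1
independenceThreshold (suc d) (suc r) =
  suc (d + independenceThreshold d (suc r) + independenceThreshold (suc d) r)

split-bound : ∀ {a b c x y z} → a + b + c ≤ x + (y + z) → x ≤ a → z < c → b ≤ y
split-bound {a} {b} {c} {x} {y} {z} sum≤ x≤a z<c = <⇒≤ (+-cancelʳ-< c b y (begin-strict
  b + c       ≤⟨ +-cancelˡ-≤ a _ _ (begin
                   a + (b + c)   ≡⟨ sym (+-assoc a b c) ⟩
                   a + b + c     ≤⟨ sum≤ ⟩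
                   x + (y + z)   ≤⟨ +-monoˡ-≤ (y + z) x≤a ⟩
                   a + (y + z)   ∎) ⟩
  y + z       <⟨ +-monoʳ-< y z<c ⟩
  y + c       ∎))
  where open ≤-Reasoning

module IndependentSets {A : Set} {_⇝_ : A → A → Set} (_⇝?_ : Decidable _⇝_) where

  outDegree : A → List A → ℕ
  outDegree u V = length (filter (u ⇝?_) V)

  OutDegreeBelow : ℕ → List A → Set
  OutDegreeBelow d V = ∀ {u} → u ∈ V → outDegree u V < d

  outDegree-mono : ∀ u {V W} → V ⊑ W → outDegree u V ≤ outDegree u W
  outDegree-mono u V⊑W = length-mono-≤ (filter⁺ (u ⇝?_) (u ⇝?_) (λ { refl p → p }) V⊑W)

  record IndependentSet (V : List A) (r : ℕ) : Set where
    field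
      vertex      : Fin r → A
      injective   : Injective _≡_ _≡_ vertex
      ∈V          : ∀ j → vertex j ∈ V
      independent : ∀ j j' → j ≢ j' → ¬ vertex j ⇝ vertex j'

  open IndependentSet public

  ∅-independent : ∀ {V} → IndependentSet V 0
  ∅-independent = record { vertex = λ (); injective = λ {}; ∈V = λ (); independent = λ () }

  weaken : ∀ {V W r} → (∀ {x} → x ∈ V → x ∈ W) → IndependentSet V r → IndependentSet W r
  weaken V⊆W I = record
    { vertex = vertex I ; injective = injective I ; ∈V = V⊆W ∘ ∈V I ; independent = independent I }

  cons : ∀ {v V r} → (∀ {x} → x ∈ V → v ≢ x × ¬ v ⇝ x × ¬ x ⇝ v) →
    IndependentSet V r → IndependentSet (v ∷ V) (suc r)
  cons {v} {V} {r} apart I = record { vertex = g ; injective = g-inj ; ∈V = g∈ ; independent = g-ind }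
    where
    g : Fin (suc r) → A
    g zero    = v
    g (suc j) = vertex I j
    g-inj : Injective _≡_ _≡_ g
    g-inj {zero}  {zero}  _ = refl
    g-inj {zero}  {suc j} e = contradiction e (proj₁ (apart (∈V I j)))
    g-inj {suc i} {zero}  e = contradiction (sym e) (proj₁ (apart (∈V I i)))
    g-inj {suc i} {suc j} e = cong suc (injective I e)
    g∈ : ∀ j → g j ∈ v ∷ V
    g∈ zero    = here refl
    g∈ (suc j) = there (∈V I j)
    g-ind : ∀ j j' → j ≢ j' → ¬ g j ⇝ g j'
    g-ind zero     zero     j≢j' = contradiction refl j≢j'
    g-ind zero     (suc j') _    = proj₁ (proj₂ (apart (∈V I j')))
    g-ind (suc j)  zero     _    = proj₂ (proj₂ (apart (∈V I j)))
    g-ind (suc j)  (suc j') j≢j' = independent I j j' (j≢j' ∘ cong suc)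

  module Split (v : A) (V : List A) where
    Out Rest In Apart : List A
    Out   = filter (v ⇝?_) V
    Rest  = filter (¬? ∘ (v ⇝?_)) V
    In    = filter (_⇝? v) Rest
    Apart = filter (¬? ∘ (_⇝? v)) Rest

    length-split : length Out + (length In + length Apart) ≡ length V
    length-split =
      trans (cong (length Out +_) (length-filter-¬ (_⇝? v) Rest)) (length-filter-¬ (v ⇝?_) V)

    In⊑V : In ⊑ V
    In⊑V = ⊆-trans (filter-⊆ (_⇝? v) Rest) (filter-⊆ (¬? ∘ (v ⇝?_)) V)

    Apart⊑V : Apart ⊑ V
    Apart⊑V = ⊆-trans (filter-⊆ (¬? ∘ (_⇝? v)) Rest) (filter-⊆ (¬? ∘ (v ⇝?_)) V)

    In! : Unique V → Unique In
    In! = Unique.filter⁺ (_⇝? v) ∘ Unique.filter⁺ (¬? ∘ (v ⇝?_))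

    Apart! : Unique V → Unique Apart
    Apart! = Unique.filter⁺ (¬? ∘ (_⇝? v)) ∘ Unique.filter⁺ (¬? ∘ (v ⇝?_))

    ∈In⁻ : ∀ {x} → x ∈ In → x ∈ V × x ⇝ v
    ∈In⁻ x∈In with x∈Rest , x⇝v ← ∈-filter⁻ (_⇝? v) x∈In =
      proj₁ (∈-filter⁻ (¬? ∘ (v ⇝?_)) x∈Rest) , x⇝v

    ∈Apart⁻ : ∀ {x} → x ∈ Apart → x ∈ V × ¬ v ⇝ x × ¬ x ⇝ v
    ∈Apart⁻ x∈Apart with x∈Rest , x↛v ← ∈-filter⁻ (¬? ∘ (_⇝? v)) x∈Apart
                    with x∈V , v↛x ← ∈-filter⁻ (¬? ∘ (v ⇝?_)) x∈Rest = x∈V , v↛x , x↛v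

  independentSet : ∀ d r {V} → Unique V → OutDegreeBelow d V →
    independenceThreshold d r ≤ length V → IndependentSet V r
  independentSet d       zero    _ _ _ = ∅-independent
  independentSet zero    (suc r) {v ∷ V} _ bounded _ = contradiction (bounded (here refl)) λ ()
  independentSet (suc d) (suc r) {v ∷ V} (v∉V ∷ V!) bounded (s≤s large) =
    branch (independenceThreshold (suc d) r ≤? length Apart)
    where
    open Split v V
    branch : Dec (independenceThreshold (suc d) r ≤ length Apart) → IndependentSet (v ∷ V) (suc r)
    branch (yes fits) =
      weaken (λ { (here refl) → here refl ; (there x∈Apart) → there (proj₁ (∈Apart⁻ x∈Apart)) })
        (cons apart (independentSet (suc d) r (Apart! V!) boundedApart fits))
      where
      apart : ∀ {x} → x ∈ Apart → v ≢ x × ¬ v ⇝ x × ¬ x ⇝ v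
      apart x∈Apart with x∈V , v↛x , x↛v ← ∈Apart⁻ x∈Apart =
        All.lookup v∉V x∈V , v↛x , x↛v
      boundedApart : OutDegreeBelow (suc d) Apart
      boundedApart {x} x∈Apart =
        ≤-<-trans (outDegree-mono x (v ∷ʳ Apart⊑V)) (bounded (there (proj₁ (∈Apart⁻ x∈Apart))))
    branch (no small) =
      weaken (there ∘ proj₁ ∘ ∈In⁻) (independentSet d (suc r) (In! V!) boundedIn
        (split-bound (≤-trans large (≤-reflexive (sym length-split))) out≤d (≰⇒> small)))
      where
      out≤d : length Out ≤ d
      out≤d = ≤-trans (outDegree-mono v (v ∷ʳ ⊆-refl)) (s≤s⁻¹ (bounded (here refl)))
      -- Every x ∈ In has the arc x ⇝ v, which In does not see.
      boundedIn : OutDegreeBelow d In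
      boundedIn {x} x∈In with x∈V , x⇝v ← ∈In⁻ x∈In = begin
        suc (outDegree x In)  ≤⟨ s≤s (outDegree-mono x In⊑V) ⟩
        suc (outDegree x V)   ≡⟨ cong length (filter-accept (x ⇝?_) x⇝v) ⟨
        outDegree x (v ∷ V)   ≤⟨ s≤s⁻¹ (bounded (there x∈V)) ⟩
        d                     ∎
        where open ≤-Reasoning

∣p∪q∣≤∣p∣+∣q∣ : ∀ {n} (p q : Subset n) → ∣ p ∪ q ∣ ≤ ∣ p ∣ + ∣ q ∣
∣p∪q∣≤∣p∣+∣q∣ []          []          = z≤n
∣p∪q∣≤∣p∣+∣q∣ (true  ∷ p) (true  ∷ q) =
  s≤s (≤-trans (∣p∪q∣≤∣p∣+∣q∣ p q) (+-monoʳ-≤ ∣ p ∣ (n≤1+n ∣ q ∣)))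
∣p∪q∣≤∣p∣+∣q∣ (true  ∷ p) (false ∷ q) = s≤s (∣p∪q∣≤∣p∣+∣q∣ p q)
∣p∪q∣≤∣p∣+∣q∣ (false ∷ p) (true  ∷ q) =
  ≤-trans (s≤s (∣p∪q∣≤∣p∣+∣q∣ p q)) (≤-reflexive (sym (+-suc ∣ p ∣ ∣ q ∣)))
∣p∪q∣≤∣p∣+∣q∣ (false ∷ p) (false ∷ q) = ∣p∪q∣≤∣p∣+∣q∣ p q

Unique∧All∈⇒length≤∣p∣ : ∀ {n} {p : Subset n} {xs} → Unique xs → All (_∈ₛ p) xs →
  length xs ≤ ∣ p ∣
Unique∧All∈⇒length≤∣p∣ []           []              = z≤n
Unique∧All∈⇒length≤∣p∣ (x∉xs ∷ xs!) (x∈p ∷ xs⊆p) =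
  ≤-trans (s≤s (Unique∧All∈⇒length≤∣p∣ xs! xs⊆p-x)) (x∈p⇒∣p-x∣<∣p∣ x∈p)
  where
  xs⊆p-x = All.zipWith (λ (y∈p , x≢y) → x∈p∧x≢y⇒x∈p-y y∈p (≢-sym x≢y)) (xs⊆p , x∉xs)

∈-pair⁺ : ∀ {n} {u v z : Fin n} → z ≡ u ⊎ z ≡ v → z ∈ₛ pair u v
∈-pair⁺ {u = u} (inj₁ refl) = x∈p∪q⁺ (inj₁ (x∈⁅x⁆ u))
∈-pair⁺ {v = v} (inj₂ refl) = x∈p∪q⁺ (inj₂ (x∈⁅x⁆ v))

module _ {n : ℕ} {u v x z : Fin n} where

  ∈-triple⁺ : z ≡ u ⊎ z ≡ v ⊎ z ≡ x → z ∈ₛ triple u v x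
  ∈-triple⁺ (inj₁ refl)        = x∈p∪q⁺ (inj₁ (x∈⁅x⁆ u))
  ∈-triple⁺ (inj₂ (inj₁ refl)) = x∈p∪q⁺ (inj₂ (x∈p∪q⁺ (inj₁ (x∈⁅x⁆ v))))
  ∈-triple⁺ (inj₂ (inj₂ refl)) = x∈p∪q⁺ (inj₂ (x∈p∪q⁺ (inj₂ (x∈⁅x⁆ x))))

  ∈-triple⁻ : z ∈ₛ triple u v x → z ≡ u ⊎ z ≡ v ⊎ z ≡ x
  ∈-triple⁻ z∈uvx with x∈p∪q⁻ ⁅ u ⁆ _ z∈uvx
  ... | inj₁ z∈u = inj₁ (x∈⁅y⁆⇒x≡y u z∈u)
  ... | inj₂ z∈vx with x∈p∪q⁻ ⁅ v ⁆ _ z∈vx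
  ...   | inj₁ z∈v = inj₂ (inj₁ (x∈⁅y⁆⇒x≡y v z∈v))
  ...   | inj₂ z∈x = inj₂ (inj₂ (x∈⁅y⁆⇒x≡y x z∈x))

∣pair∣≤2 : ∀ {n} (u v : Fin n) → ∣ pair u v ∣ ≤ 2
∣pair∣≤2 u v =
  ≤-trans (∣p∪q∣≤∣p∣+∣q∣ ⁅ u ⁆ ⁅ v ⁆) (≤-reflexive (cong₂ _+_ (∣⁅x⁆∣≡1 u) (∣⁅x⁆∣≡1 v)))

triple-⊆ : ∀ {n} {h : Subset n} {u v x} → u ∈ₛ h → v ∈ₛ h → x ∈ₛ h → triple u v x ⊆ h
triple-⊆ u∈h v∈h x∈h z∈uvx with ∈-triple⁻ z∈uvx
... | inj₁ refl        = u∈h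
... | inj₂ (inj₁ refl) = v∈h
... | inj₂ (inj₂ refl) = x∈h

edge⊇pair⇒triple : ∀ (H : Hypergraph3) {u v h} → u ≢ v → Edge H h → pair u v ⊆ h →
  ∃[ x ] x ≢ u × x ≢ v × h ≡ triple u v x
edge⊇pair⇒triple H {u} {v} {h} u≢v edge uv⊆h
  with any? (λ x → (x ∈ₛ? h) ×-dec (¬? (x ≟ᶠ u)) ×-dec (¬? (x ≟ᶠ v)))
... | yes (x , x∈h , x≢u , x≢v) = x , x≢u , x≢v , ⊆-antisym h⊆uvx (triple-⊆ u∈h v∈h x∈h)
  where
  u∈h : u ∈ₛ h
  u∈h = uv⊆h (∈-pair⁺ (inj₁ refl))
  v∈h : v ∈ₛ h
  v∈h = uv⊆h (∈-pair⁺ (inj₂ refl))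
  h⊆uvx : h ⊆ triple u v x
  h⊆uvx {z} z∈h with z ≟ᶠ u | z ≟ᶠ v | z ≟ᶠ x
  ... | yes z≡u | _       | _       = ∈-triple⁺ (inj₁ z≡u)
  ... | no _    | yes z≡v | _       = ∈-triple⁺ (inj₂ (inj₁ z≡v))
  ... | no _    | no _    | yes z≡x = ∈-triple⁺ (inj₂ (inj₂ z≡x))
  ... | no z≢u  | no z≢v  | no z≢x  = contradiction (uniform H h edge) (<⇒≢ 3<∣h∣ ∘ sym)
    where
    3<∣h∣ : 3 < ∣ h ∣
    3<∣h∣ = Unique∧All∈⇒length≤∣p∣
      ((z≢x ∷ z≢v ∷ z≢u ∷ []) ∷ (x≢v ∷ x≢u ∷ []) ∷ (≢-sym u≢v ∷ []) ∷ [] ∷ [])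
      (z∈h ∷ x∈h ∷ v∈h ∷ u∈h ∷ [])
... | no no-third = contradiction (uniform H h edge) (<⇒≢ ∣h∣<3)
  where
  h⊆uv : h ⊆ pair u v
  h⊆uv {z} z∈h with z ≟ᶠ u | z ≟ᶠ v
  ... | yes z≡u | _       = ∈-pair⁺ (inj₁ z≡u)
  ... | no _    | yes z≡v = ∈-pair⁺ (inj₂ z≡v)
  ... | no z≢u  | no z≢v  = contradiction (z , z∈h , z≢u , z≢v) no-third
  ∣h∣<3 : ∣ h ∣ < 3
  ∣h∣<3 = s≤s (≤-trans (p⊆q⇒∣p∣≤∣q∣ h⊆uv) (∣pair∣≤2 u v))

module _ {A : Set} {P Q : A → Set} where

  AtLeast-map : ∀ {m} → (∀ {x} → P x → Q x) → AtLeast m P → AtLeast m Q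
  AtLeast-map P⇒Q (f , f-inj , Pf) = f , f-inj , P⇒Q ∘ Pf

AtLeast-avoid : ∀ {A : Set} {P : A → Set} {m} → DecidableEquality A →
  (y : A) → AtLeast (suc m) P → AtLeast m (λ x → P x × x ≢ y)
AtLeast-avoid _≟_ y (f , f-inj , Pf) with any? (λ t → f t ≟ y)
... | yes (t , ft≡y) = f ∘ punchIn t , punchIn-injective t _ _ ∘ f-inj ,
                       λ s → Pf (punchIn t s) , λ e → punchInᵢ≢i t s (f-inj (trans e (sym ft≡y)))
... | no  no-hit    = f ∘ suc , suc-injective ∘ f-inj , λ s → Pf (suc s) , λ e → no-hit (suc s , e)

AtLeast-∈-tabulate : ∀ {A : Set} {P : A → Set} {m} (X : AtLeast m P) →
  AtLeast m (λ x → P x × x ∈ tabulate (proj₁ X))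
AtLeast-∈-tabulate (f , f-inj , Pf) = f , f-inj , λ t → Pf t , ∈-tabulate⁺ t

linkVertices : ∀ (H : Hypergraph3) {m u v} → u ≢ v → PairDegAtLeast H m u v →
  AtLeast m (λ x → InLink H u v x × x ≢ u × x ≢ v)
linkVertices H {u = u} {v} u≢v (h , h-inj , h⊇uv) = proj₁ ∘ third , third-inj , link
  where
  third : ∀ t → ∃[ x ] x ≢ u × x ≢ v × h t ≡ triple u v x
  third t = edge⊇pair⇒triple H u≢v (proj₁ (h⊇uv t)) (proj₂ (h⊇uv t))
  h≡ : ∀ t → h t ≡ triple u v (proj₁ (third t))
  h≡ t = proj₂ (proj₂ (proj₂ (third t)))
  third-inj : Injective _≡_ _≡_ (proj₁ ∘ third)
  third-inj {t} {t'} e = h-inj (trans (h≡ t) (trans (cong (triple u v) e) (sym (h≡ t'))))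
  link : ∀ t → InLink H u v (proj₁ (third t)) × proj₁ (third t) ≢ u × proj₁ (third t) ≢ v
  link t = subst (Edge H) (h≡ t) (proj₁ (h⊇uv t))
         , proj₁ (proj₂ (third t)) , proj₁ (proj₂ (proj₂ (third t)))

module StarDigraph {H : Hypergraph3} {q k : ℕ} (S : Star H q) (w : Weights S k) where

  LinkVertex : Fin (n H) → Fin (n H) → Fin (n H) → Set
  LinkVertex u v x = InLink H u v x × x ≢ u × x ≢ v

  LinkVertices : ℕ → Fin (n H) → Fin (n H) → Set
  LinkVertices m u v = AtLeast (suc m) (LinkVertex u v)

  links-ca : ∀ i → LinkVertices (wca w i) (c S) (a S i)
  links-ca i = linkVertices H (≢-sym (a≢c S i)) (degca w i)

  links-cb : ∀ i → LinkVertices (wcb w i) (c S) (b S i)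
  links-cb i = linkVertices H (≢-sym (b≢c S i)) (degcb w i)

  links-ab : ∀ i → LinkVertices (wab w i) (a S i) (b S i)
  links-ab i = linkVertices H (a≢b S i i) (degab w i)

  links : Fin q → List (Fin (n H))
  links i =
    tabulate (proj₁ (links-ca i)) ++ tabulate (proj₁ (links-cb i)) ++ tabulate (proj₁ (links-ab i))

  length-links : ∀ i → length (links i) ≤ 3 * suc k
  length-links i = begin
    length (links i)
      ≡⟨ length-tabulate-++ (proj₁ (links-ca i)) _ ⟩
    suc (wca w i) + length (tabulate (proj₁ (links-cb i)) ++ tabulate (proj₁ (links-ab i)))
      ≡⟨ cong (suc (wca w i) +_) (length-tabulate-++ (proj₁ (links-cb i)) _) ⟩
    suc (wca w i) + (suc (wcb w i) + length (tabulate (proj₁ (links-ab i))))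
      ≡⟨ cong (λ l → suc (wca w i) + (suc (wcb w i) + l)) (length-tabulate (proj₁ (links-ab i))) ⟩
    suc (wca w i) + (suc (wcb w i) + suc (wab w i))
      ≤⟨ +-mono-≤ (s≤s (wca≤ w i)) (+-mono-≤ (s≤s (wcb≤ w i)) (s≤s (wab≤ w i))) ⟩
    suc k + (suc k + suc k)
      ≡⟨ cong (λ l → suc k + (suc k + l)) (+-identityʳ (suc k)) ⟨
    3 * suc k
      ∎
    where open ≤-Reasoning

  InPetal : Fin q → Fin (n H) → Set
  InPetal j x = a S j ≡ x ⊎ b S j ≡ x

  InPetal-unique : ∀ {i j x} → InPetal i x → InPetal j x → i ≡ j
  InPetal-unique {i} {j} (inj₁ refl) (inj₁ aj≡ai) = sym (a-inj S aj≡ai)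
  InPetal-unique {i} {j} (inj₁ refl) (inj₂ bj≡ai) = contradiction (sym bj≡ai) (a≢b S i j)
  InPetal-unique {i} {j} (inj₂ refl) (inj₁ aj≡bi) = contradiction aj≡bi (a≢b S j i)
  InPetal-unique {i} {j} (inj₂ refl) (inj₂ bj≡bi) = sym (b-inj S bj≡bi)

  petal : Fin (n H) → Maybe (Fin q)
  petal x with any? (λ j → (a S j ≟ᶠ x) ⊎-dec (b S j ≟ᶠ x))
  ... | yes (j , _) = just j
  ... | no  _       = nothing

  petal-spec : ∀ {j x} → InPetal j x → petal x ≡ just j
  petal-spec {j} {x} jx with any? (λ j → (a S j ≟ᶠ x) ⊎-dec (b S j ≟ᶠ x))
  ... | yes (j' , j'x) = cong just (InPetal-unique j'x jx)
  ... | no  none       = contradiction (j , jx) none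

  _⇝_ : Fin q → Fin q → Set
  i ⇝ j = j ∈ mapMaybe petal (links i)

  _⇝?_ : Decidable _⇝_
  i ⇝? j = j ∈? mapMaybe petal (links i)
    where open DecMembership _≟ᶠ_

  open IndependentSets _⇝?_ public

  links-hit : ∀ {i j x} → x ∈ links i → InPetal j x → i ⇝ j
  links-hit x∈links jx = ∈-mapMaybe⁺ {f = petal} x∈links (petal-spec jx)

  outDegree-bounded : OutDegreeBelow (suc (3 * suc k)) (allFin q)
  outDegree-bounded {i} _ = s≤s (begin
    outDegree i (allFin q)
      ≤⟨ Unique⇒length≤ (Unique.filter⁺ (i ⇝?_) (Unique.allFin⁺ q))
                        (proj₂ ∘ ∈-filter⁻ (i ⇝?_) {xs = allFin q}) ⟩
    length (mapMaybe petal (links i))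
      ≤⟨ length-mapMaybe petal (links i) ⟩
    length (links i)
      ≤⟨ length-links i ⟩
    3 * suc k
      ∎)
    where open ≤-Reasoning

  independentPetals : ∀ r → independenceThreshold (suc (3 * suc k)) r ≤ q → IndependentSet (allFin q) r
  independentPetals r large =
    independentSet _ r (Unique.allFin⁺ q) outDegree-bounded
      (≤-trans large (≤-reflexive (sym (length-tabulate id))))

  module _ {r} (I : IndependentSet (allFin q) r) where

    outside : ∀ j₀ {x} → x ∈ links (vertex I j₀) →
      x ≢ c S → x ≢ a S (vertex I j₀) → x ≢ b S (vertex I j₀) → NotInSub S (vertex I) x
    outside j₀ {x} x∈links x≢c x≢a x≢b =
      x≢c , avoid (a S) (inj₁ ∘ sym) x≢a , avoid (b S) (inj₂ ∘ sym) x≢b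
      where
      avoid : ∀ (f : Fin q → Fin (n H)) → (∀ {j} → x ≡ f j → InPetal j x) →
        x ≢ f (vertex I j₀) → ∀ j → x ≢ f (vertex I j)
      avoid f petal-f x≢f₀ j with j ≟ᶠ j₀
      ... | yes refl = x≢f₀
      ... | no  j≢j₀ = independent I j₀ j (≢-sym j≢j₀) ∘ links-hit x∈links ∘ petal-f

    -- own is the vertex of the j₀-th hyperedge other than u and v.
    goodPair : ∀ j₀ {m u v} (own : Fin (n H)) (X : LinkVertices m u v) →
      (∀ {x} → x ∈ tabulate (proj₁ X) → x ∈ links (vertex I j₀)) →
      (∀ {x} → x ≢ u → x ≢ v → x ≢ own →
         x ≢ c S × x ≢ a S (vertex I j₀) × x ≢ b S (vertex I j₀)) →
      GoodPair S (vertex I) m u v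
    goodPair j₀ {m} {u} {v} own X X⊆links cover =
      AtLeast-map (λ {x} → outsideLink {x})
        (AtLeast-avoid {P = Listed} _≟ᶠ_ own (AtLeast-∈-tabulate {P = LinkVertex u v} X))
      where
      Listed : Fin (n H) → Set
      Listed x = LinkVertex u v x × x ∈ tabulate (proj₁ X)
      outsideLink : ∀ {x} → Listed x × x ≢ own →
        InLink H u v x × NotInSub S (vertex I) x
      outsideLink (((link , x≢u , x≢v) , x∈X) , x≢own)
        with x≢c , x≢a , x≢b ← cover x≢u x≢v x≢own =
        link , outside j₀ (X⊆links x∈X) x≢c x≢a x≢b

    nice : Nice S w (vertex I)
    nice j =
        goodPair j (b S i) (links-ca i) ∈-++⁺ˡ                   (λ ≢c ≢a ≢b → ≢c , ≢a , ≢b)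
      , goodPair j (a S i) (links-cb i) (∈-++⁺ʳ Eca ∘ ∈-++⁺ˡ)     (λ ≢c ≢b ≢a → ≢c , ≢a , ≢b)
      , goodPair j (c S)   (links-ab i) (∈-++⁺ʳ Eca ∘ ∈-++⁺ʳ Ecb) (λ ≢a ≢b ≢c → ≢c , ≢a , ≢b)
      where
      i = vertex I j
      Eca = tabulate (proj₁ (links-ca i))
      Ecb = tabulate (proj₁ (links-cb i))

lemma2 : ∀ (k r : ℕ) → 1 ≤ k → 1 ≤ r →
    ∃[ q₀ ] ∀ (q : ℕ) → q₀ ≤ q →
      ∀ (H : Hypergraph3) (S : Star H q) (w : Weights S k) →
        Σ (Fin r → Fin q) (λ g → Injective _≡_ _≡_ g × Nice S w g)
lemma2 k r _ _ = independenceThreshold (suc (3 * suc k)) r , λ q large H S w →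
  let open StarDigraph S w
      I = independentPetals r large
  in vertex I , injective I , nice I
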